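{- Let $c$ be a positive integer and suppose either $(n,m,k,\ell)=(2,6,2,2)$ or $(n,m,k,\ell)=(2,6,3,1)$. Consider the equation $x^n+y^m=c\,x^k y^\ell$ in positive integers $x,y$. If $c\neq 2$, the equation has no positive integer solution. If $c=2$, $(x,y)=(1,1)$ is the unique solution.
   Context: A solution means an ordered pair $(x,y)$ of positive integers satisfying the equation. -}

module Defs where

open import Data.Nat using (ℕ; _+_; _*_; _^_; _≤_)
open import Data.Product using (_×_)
open import Relation.Binary.PropositionalEquality using (_≡_)

IsSolution : (n m k ℓ c x y : ℕ) → Set
IsSolution n m k ℓ c x y = (1 ≤ x) × (1 ≤ y) × (x ^ n + y ^ m ≡ c * (x ^ k) * (y ^ ℓ))

{-# OPTIONS --safe #-}
-- Both equations read x² + y⁶ = R x² with R = c y² resp. R = c x y, so y ∣ R.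
-- Then x² ∣ (y³)², so y³ = t x and R = t² + 1. As y ∣ t² + 1, t is coprime to y,
-- and t ∣ y³ forces t = 1. Hence x = y³ and R = 2, which leaves c y² = 2
-- resp. c y⁴ = 2, i.e. y = 1 and c = 2.
module Submission where

open import Defs
open import Data.Nat using (ℕ; suc; _+_; _*_; _^_; _≤_; _<_; z≤n; s≤s; NonZero; >-nonZero; ≢-nonZero; ≢-nonZero⁻¹)
open import Data.Nat.Properties
  using (*-cancelʳ-≡; *-identityˡ; *-identityʳ; *-zeroʳ; *-comm; ^-zeroˡ; ^-distribˡ-+-*; ^-monoˡ-≤; ^-monoʳ-≤;
         m≤m+n; m≤n*m; m*n≢0; <-irrefl; module ≤-Reasoning)
open import Data.Nat.Divisibility
  using (_∣_; divides; ∣-refl; ∣-trans; ∣1⇒≡1; ∣m+n∣m⇒∣n; ∣m⇒∣m*n; ∣n⇒∣m*n; m∣m*n; n∣m*n;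
         m*n∣⇒m∣; *-cancelʳ-∣)
open import Data.Nat.DivMod using (_/_; m/n*n≡m)
open import Data.Nat.GCD using (gcd; gcd[m,n]∣m; gcd[m,n]∣n; gcd[m,n]≢0)
open import Data.Nat.Coprimality using (Coprime; coprime-divisor; coprime-/gcd)
open import Data.Nat.Solver using (module +-*-Solver)
open import Data.Product using (_×_; _,_; proj₁; proj₂; ∃-syntax)
open import Data.Sum using (_⊎_; inj₁; inj₂)
open import Relation.Binary.PropositionalEquality
  using (_≡_; _≢_; refl; sym; trans; cong; subst; subst₂; module ≡-Reasoning)
open import Relation.Nullary using (¬_; contradiction)

open +-*-Solver

private
  variable
    m n : ℕ

m*m∣n*n⇒m∣n : .{{_ : NonZero m}} → m * m ∣ n * n → m ∣ n
m*m∣n*n⇒m∣n {m} {n} m²∣n² = subst (_∣ n) (sym m≡g) (gcd[m,n]∣n m n)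
  where
  g p q : ℕ
  g = gcd m n
  instance
    g≢0 : NonZero g
    g≢0 = ≢-nonZero (gcd[m,n]≢0 m n (inj₁ (≢-nonZero⁻¹ m)))
  p = m / g
  q = n / g
  m≡p*g : m ≡ p * g
  m≡p*g = sym (m/n*n≡m (gcd[m,n]∣m m n))
  n≡q*g : n ≡ q * g
  n≡q*g = sym (m/n*n≡m (gcd[m,n]∣n m n))
  regroup : ∀ a g → a * g * (a * g) ≡ a * a * (g * g)
  regroup = solve 2 (λ a g → a :* g :* (a :* g) := a :* a :* (g :* g)) refl
  p²∣q² : p * p ∣ q * q
  p²∣q² = *-cancelʳ-∣ (g * g) {{m*n≢0 g g}}
    (subst₂ _∣_ (trans (cong (λ a → a * a) m≡p*g) (regroup p g))
                (trans (cong (λ a → a * a) n≡q*g) (regroup q g)) m²∣n²)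
  p≡1 : p ≡ 1
  p≡1 = coprime-/gcd m n (∣-refl , coprime-divisor (coprime-/gcd m n) (m*n∣⇒m∣ p p p²∣q²))
  m≡g : m ≡ g
  m≡g = trans m≡p*g (trans (cong (_* g) p≡1) (*-identityˡ g))

∣m*m+1⇒coprime : n ∣ m * m + 1 → Coprime m n
∣m*m+1⇒coprime n∣m²+1 (i∣m , i∣n) =
  ∣1⇒≡1 (∣m+n∣m⇒∣n (∣-trans i∣n n∣m²+1) (∣m⇒∣m*n _ i∣m))

coprime∧∣^⇒≡1 : ∀ k → Coprime m n → m ∣ n ^ k → m ≡ 1
coprime∧∣^⇒≡1 0       _   m∣1   = ∣1⇒≡1 m∣1
coprime∧∣^⇒≡1 (suc k) cop m∣nᵏ⁺¹ = coprime∧∣^⇒≡1 k cop (coprime-divisor cop m∣nᵏ⁺¹)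

m*n^[2+k]≡2⇒n≡1∧m≡2 : ∀ k → m * n ^ (2 + k) ≡ 2 → n ≡ 1 × m ≡ 2
m*n^[2+k]≡2⇒n≡1∧m≡2 {m} {0} k eq = contradiction (trans (sym (*-zeroʳ m)) eq) λ ()
m*n^[2+k]≡2⇒n≡1∧m≡2 {m} {1} k eq = refl , (begin
  m                  ≡⟨ sym (*-identityʳ m) ⟩
  m * 1              ≡⟨ cong (m *_) (sym (^-zeroˡ (2 + k))) ⟩
  m * 1 ^ (2 + k)    ≡⟨ eq ⟩
  2                  ∎)
  where open ≡-Reasoning
m*n^[2+k]≡2⇒n≡1∧m≡2 {0} {suc (suc _)} k ()
m*n^[2+k]≡2⇒n≡1∧m≡2 {m@(suc _)} {n@(suc (suc _))} k eq = contradiction 2<m*nᵏ⁺² (<-irrefl (sym eq))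
  where
  open ≤-Reasoning
  2<m*nᵏ⁺² : 2 < m * n ^ (2 + k)
  2<m*nᵏ⁺² = begin-strict
    2               <⟨ s≤s (s≤s (s≤s z≤n)) ⟩
    2 ^ 2           ≤⟨ ^-monoʳ-≤ 2 (m≤m+n 2 k) ⟩
    2 ^ (2 + k)     ≤⟨ ^-monoˡ-≤ (2 + k) (s≤s (s≤s z≤n)) ⟩
    n ^ (2 + k)     ≤⟨ m≤n*m (n ^ (2 + k)) m ⟩
    m * n ^ (2 + k) ∎

^2≡* : ∀ x → x ^ 2 ≡ x * x
^2≡* = solve 1 (λ x → x :^ 2 := x :* x) refl

x^2+tx*tx≡[t*t+1]*x*x : ∀ x t → x ^ 2 + t * x * (t * x) ≡ (t * t + 1) * (x * x)
x^2+tx*tx≡[t*t+1]*x*x = solve 2 (λ x t → x :^ 2 :+ t :* x :* (t :* x) := (t :* t :+ con 1) :* (x :* x)) refl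

x^2+y^6≡R*x^2⇒y^3≡t*x : ∀ {x y R} .{{_ : NonZero x}} → x ^ 2 + y ^ 6 ≡ R * x ^ 2 →
                         ∃[ t ] y ^ 3 ≡ t * x × R ≡ t * t + 1
x^2+y^6≡R*x^2⇒y^3≡t*x {x} {y} {R} eq = write (m*m∣n*n⇒m∣n x*x∣y³*y³)
  where
  x*x∣y³*y³ : x * x ∣ y ^ 3 * y ^ 3
  x*x∣y³*y³ = subst₂ _∣_ (^2≡* x) (^-distribˡ-+-* y 3 3)
    (∣m+n∣m⇒∣n (subst (x ^ 2 ∣_) (sym eq) (n∣m*n R)) ∣-refl)
  write : x ∣ y ^ 3 → ∃[ t ] y ^ 3 ≡ t * x × R ≡ t * t + 1
  write (divides t y³≡t*x) = t , y³≡t*x , *-cancelʳ-≡ R (t * t + 1) (x * x) {{m*n≢0 x x}} (begin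
    R * (x * x)               ≡⟨ cong (R *_) (sym (^2≡* x)) ⟩
    R * x ^ 2                 ≡⟨ sym eq ⟩
    x ^ 2 + y ^ 6             ≡⟨ cong (x ^ 2 +_) (^-distribˡ-+-* y 3 3) ⟩
    x ^ 2 + y ^ 3 * y ^ 3     ≡⟨ cong (λ z → x ^ 2 + z * z) y³≡t*x ⟩
    x ^ 2 + t * x * (t * x)   ≡⟨ x^2+tx*tx≡[t*t+1]*x*x x t ⟩
    (t * t + 1) * (x * x)     ∎)
    where open ≡-Reasoning

x^2+y^6≡R*x^2⇒x≡y^3∧R≡2 : ∀ {x y R} .{{_ : NonZero x}} → y ∣ R → x ^ 2 + y ^ 6 ≡ R * x ^ 2 →
                           x ≡ y ^ 3 × R ≡ 2
x^2+y^6≡R*x^2⇒x≡y^3∧R≡2 {x} {y} {R} y∣R eq = conclude (x^2+y^6≡R*x^2⇒y^3≡t*x {x} {y} {R} eq)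
  where
  conclude : ∃[ t ] y ^ 3 ≡ t * x × R ≡ t * t + 1 → x ≡ y ^ 3 × R ≡ 2
  conclude (t , y³≡t*x , R≡t*t+1) = sym y³≡x , trans R≡t*t+1 (cong (λ s → s * s + 1) t≡1)
    where
    t≡1 : t ≡ 1
    t≡1 = coprime∧∣^⇒≡1 3 (∣m*m+1⇒coprime (subst (y ∣_) R≡t*t+1 y∣R))
                          (divides x (trans y³≡t*x (*-comm t x)))
    y³≡x : y ^ 3 ≡ x
    y³≡x = trans y³≡t*x (trans (cong (_* x) t≡1) (*-identityˡ x))

x≡y^3∧c*y^[2+k]≡2⇒x≡1∧y≡1∧c≡2 : ∀ k {c x y} → x ≡ y ^ 3 → c * y ^ (2 + k) ≡ 2 → (x ≡ 1 × y ≡ 1) × c ≡ 2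
x≡y^3∧c*y^[2+k]≡2⇒x≡1∧y≡1∧c≡2 k {c} {x} {y} x≡y³ eq with m*n^[2+k]≡2⇒n≡1∧m≡2 {c} {y} k eq
... | refl , c≡2 = (x≡y³ , refl) , c≡2

solution₂₂⇒x≡1∧y≡1∧c≡2 : ∀ {c x y} → IsSolution 2 6 2 2 c x y → (x ≡ 1 × y ≡ 1) × c ≡ 2
solution₂₂⇒x≡1∧y≡1∧c≡2 {c} {x} {y} (1≤x , _ , eq) =
  let x≡y³ , cy²≡2 = x^2+y^6≡R*x^2⇒x≡y^3∧R≡2 {x} {y} {c * y ^ 2} {{>-nonZero 1≤x}}
                       (∣n⇒∣m*n c (m∣m*n (y * 1))) (trans eq (regroup c x y))
  in x≡y^3∧c*y^[2+k]≡2⇒x≡1∧y≡1∧c≡2 0 x≡y³ cy²≡2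
  where
  regroup : ∀ c x y → c * x ^ 2 * y ^ 2 ≡ c * y ^ 2 * x ^ 2
  regroup = solve 3 (λ c x y → c :* x :^ 2 :* y :^ 2 := c :* y :^ 2 :* x :^ 2) refl

solution₃₁⇒x≡1∧y≡1∧c≡2 : ∀ {c x y} → IsSolution 2 6 3 1 c x y → (x ≡ 1 × y ≡ 1) × c ≡ 2
solution₃₁⇒x≡1∧y≡1∧c≡2 {c} {x} {y} (1≤x , _ , eq) =
  let x≡y³ , cxy≡2 = x^2+y^6≡R*x^2⇒x≡y^3∧R≡2 {x} {y} {c * x * y} {{>-nonZero 1≤x}}
                       (n∣m*n (c * x)) (trans eq (regroup c x y))
  in x≡y^3∧c*y^[2+k]≡2⇒x≡1∧y≡1∧c≡2 2 x≡y³ (begin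
    c * y ^ 4      ≡⟨ sym (cy³y≡cy⁴ c y) ⟩
    c * y ^ 3 * y  ≡⟨ cong (λ z → c * z * y) (sym x≡y³) ⟩
    c * x * y      ≡⟨ cxy≡2 ⟩
    2              ∎)
  where
  open ≡-Reasoning
  regroup : ∀ c x y → c * x ^ 3 * y ^ 1 ≡ c * x * y * x ^ 2
  regroup = solve 3 (λ c x y → c :* x :^ 3 :* y :^ 1 := c :* x :* y :* x :^ 2) refl
  cy³y≡cy⁴ : ∀ c y → c * y ^ 3 * y ≡ c * y ^ 4
  cy³y≡cy⁴ = solve 2 (λ c y → c :* y :^ 3 :* y := c :* y :^ 4) refl

solution⇒x≡1∧y≡1∧c≡2 : ∀ {k ℓ c x y} → (k ≡ 2 × ℓ ≡ 2) ⊎ (k ≡ 3 × ℓ ≡ 1) →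
                        IsSolution 2 6 k ℓ c x y → (x ≡ 1 × y ≡ 1) × c ≡ 2
solution⇒x≡1∧y≡1∧c≡2 (inj₁ (refl , refl)) = solution₂₂⇒x≡1∧y≡1∧c≡2
solution⇒x≡1∧y≡1∧c≡2 (inj₂ (refl , refl)) = solution₃₁⇒x≡1∧y≡1∧c≡2

one-one-solution : ∀ {k ℓ} → (k ≡ 2 × ℓ ≡ 2) ⊎ (k ≡ 3 × ℓ ≡ 1) → IsSolution 2 6 k ℓ 2 1 1
one-one-solution (inj₁ (refl , refl)) = s≤s z≤n , s≤s z≤n , refl
one-one-solution (inj₂ (refl , refl)) = s≤s z≤n , s≤s z≤n , refl

mainTheorem6 : (k ℓ : ℕ) → ((k ≡ 2 × ℓ ≡ 2) ⊎ (k ≡ 3 × ℓ ≡ 1)) → (c : ℕ) → 1 ≤ c →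
    ((c ≢ 2 → (x y : ℕ) → ¬ IsSolution 2 6 k ℓ c x y)
    × (c ≡ 2 → IsSolution 2 6 k ℓ c 1 1 × ((x y : ℕ) → IsSolution 2 6 k ℓ c x y → x ≡ 1 × y ≡ 1)))
mainTheorem6 k ℓ kℓ c _ = no-solution , unique-solution
  where
  no-solution : c ≢ 2 → (x y : ℕ) → ¬ IsSolution 2 6 k ℓ c x y
  no-solution c≢2 x y sol = c≢2 (proj₂ (solution⇒x≡1∧y≡1∧c≡2 {c = c} {x} {y} kℓ sol))
  unique-solution : c ≡ 2 → IsSolution 2 6 k ℓ c 1 1 × ((x y : ℕ) → IsSolution 2 6 k ℓ c x y → x ≡ 1 × y ≡ 1)
  unique-solution c≡2 = subst (λ c → IsSolution 2 6 k ℓ c 1 1) (sym c≡2) (one-one-solution kℓ)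
                      , λ x y sol → proj₁ (solution⇒x≡1∧y≡1∧c≡2 {c = c} {x} {y} kℓ sol)
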